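{- Let $D$ be a finite or infinite digraph. (a) The following are equivalent: (i) $D$ has a point-basis; (ii) $D$ has an arc-basis; (iii) the shadow of every vertex of $D$ contains an initial strong component of $D$; (iv) the shadow (in $D^*$) of every vertex of the condensation $D^*$ contains a source of $D^*$; (v) every point-reaching set of $D$ contains a point-basis of $D$; (vi) every arc-reaching set of $D$ contains an arc-basis of $D$. (b) A point-basis and an arc-basis of $D$ exist whenever $D^*$ contains no in-ray; in particular, whenever $D$ has only finitely many strong components, and in particular whenever $D$ is finite.
   Context: $D$ is a digraph with vertex set $X(D)$ (arcs are ordered pairs of distinct vertices), possibly infinite. $v$ is reachable from $u$ if there is a directed path (possibly of length $0$) from $u$ to $v$. The shadow of $u$ is the set of vertices from which $u$ is reachable. A strong component is a maximal subdigraph in which every vertex is reachable from every other; it is initial if no arc enters it from outside. A source is a vertex of in-degree $0$. The condensation $D^*$ has one vertex for each strong component of $D$, with an arc $(C_1,C_2)$ iff $C_1\ne C_2$ and some arc $(u,v)$ of $D$ has $u\in C_1$, $v\in C_2$. An in-ray in a digraph is a one-way infinite directed path $(\dots,v_2,v_1,v_0)$ whose vertex set is not contained in the union of finitely many strong components of that digraph. A point-reaching set is $S\subseteq X(D)$ such that every vertex is reachable from some vertex of $S$; a point-basis is an inclusion-minimal point-reaching set. An arc-reaching set is $S\subseteq X(D)$ such that for every arc $(u,v)$, $u$ is reachable from some vertex of $S$; an arc-basis is an inclusion-minimal arc-reaching set. -}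

module Defs where

open import Level using (Level; _⊔_) renaming (suc to lsuc)
open import Data.Nat using (ℕ) renaming (suc to sucℕ)
open import Data.Fin using (Fin)
open import Data.Product using (Σ; Σ-syntax; _×_; _,_; proj₁; proj₂)
open import Data.List using (List)
open import Data.List.Relation.Unary.All using (All)
open import Data.List.Relation.Unary.Any using (Any)
open import Data.Empty using (⊥)
open import Relation.Nullary using (¬_)
open import Relation.Unary using (Pred; _⊆_)
open import Relation.Binary using (Rel; IsEquivalence)
open import Relation.Binary.PropositionalEquality using (_≡_) renaming (isEquivalence to ≡-isEquivalence)

-- Global choice of canonical representatives for an equivalence relation
-- (a consequence of the axiom of choice).
RepresentativeChoice : ∀ a ℓ → Set (lsuc (a ⊔ ℓ))
RepresentativeChoice a ℓ =
  {A : Set a} (R : Rel A ℓ) → IsEquivalence R →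
  Σ (A → A) λ r → (∀ x → R x (r x)) × (∀ x y → R x y → r x ≡ r y)

-- Digraphs whose vertex "set" is a setoid.  The digraph D of the paper
-- uses propositional equality; its condensation D* has strong components
-- (predicates) as vertices, compared extensionally.

record Digraph (c ℓ a : Level) : Set (lsuc (c ⊔ ℓ ⊔ a)) where
  field
    Vtx           : Set c
    _≈_           : Rel Vtx ℓ
    isEquivalence : IsEquivalence _≈_
    Arc           : Rel Vtx a

module _ {c ℓ a : Level} (G : Digraph c ℓ a) where
  open Digraph G

  data Reach : Vtx → Vtx → Set (c ⊔ ℓ ⊔ a) where
    here : ∀ {x y} → x ≈ y → Reach x y
    step : ∀ {x y z} → Arc x y → Reach y z → Reach x z

  Shadow : Vtx → Pred Vtx (c ⊔ ℓ ⊔ a)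
  Shadow u w = Reach w u

  data ReachIn (C : Pred Vtx (c ⊔ ℓ)) : Vtx → Vtx → Set (c ⊔ ℓ ⊔ a) where
    here : ∀ {x y} → C x → C y → x ≈ y → ReachIn C x y
    step : ∀ {x y z} → C x → Arc x y → ReachIn C y z → ReachIn C x z

  StronglyConnected : Pred Vtx (c ⊔ ℓ) → Set (c ⊔ ℓ ⊔ a)
  StronglyConnected C = ∀ x y → C x → C y → ReachIn C x y

  IsStrongComponent : Pred Vtx (c ⊔ ℓ) → Set (lsuc (c ⊔ ℓ) ⊔ a)
  IsStrongComponent C =
    (∀ {x y} → x ≈ y → C x → C y) ×
    (Σ Vtx C) ×
    StronglyConnected C ×
    (∀ (C′ : Pred Vtx (c ⊔ ℓ)) → C ⊆ C′ → StronglyConnected C′ → C′ ⊆ C)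

  IsInitialStrongComponent : Pred Vtx (c ⊔ ℓ) → Set (lsuc (c ⊔ ℓ) ⊔ a)
  IsInitialStrongComponent C =
    IsStrongComponent C × (∀ u v → Arc u v → ¬ C u → C v → ⊥)

  IsSource : Vtx → Set (c ⊔ a)
  IsSource x = ∀ u → ¬ Arc u x

  InRay : Set (lsuc (c ⊔ ℓ) ⊔ a)
  InRay = Σ (ℕ → Vtx) λ f →
    (∀ n → Arc (f (sucℕ n)) (f n)) ×
    (∀ i j → f i ≈ f j → i ≡ j) ×
    ¬ (Σ (List (Pred Vtx (c ⊔ ℓ))) λ Cs →
         All IsStrongComponent Cs × (∀ n → Any (λ C → C (f n)) Cs))

  HasInRay : Set (lsuc (c ⊔ ℓ) ⊔ a)
  HasInRay = InRay

  PointReaching : Pred Vtx (c ⊔ ℓ) → Set (c ⊔ ℓ ⊔ a)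
  PointReaching S = ∀ v → Σ Vtx λ u → S u × Reach u v

  ArcReaching : Pred Vtx (c ⊔ ℓ) → Set (c ⊔ ℓ ⊔ a)
  ArcReaching S = ∀ u v → Arc u v → Σ Vtx λ w → S w × Reach w u

  IsPointBasis : Pred Vtx (c ⊔ ℓ) → Set (lsuc (c ⊔ ℓ) ⊔ a)
  IsPointBasis S =
    PointReaching S × (∀ T → T ⊆ S → PointReaching T → S ⊆ T)

  IsArcBasis : Pred Vtx (c ⊔ ℓ) → Set (lsuc (c ⊔ ℓ) ⊔ a)
  IsArcBasis S =
    ArcReaching S × (∀ T → T ⊆ S → ArcReaching T → S ⊆ T)

  HasPointBasis : Set (lsuc (c ⊔ ℓ) ⊔ a)
  HasPointBasis = Σ (Pred Vtx (c ⊔ ℓ)) IsPointBasis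

  HasArcBasis : Set (lsuc (c ⊔ ℓ) ⊔ a)
  HasArcBasis = Σ (Pred Vtx (c ⊔ ℓ)) IsArcBasis

digraph : (V : Set) → Rel V Level.zero → Digraph Level.zero Level.zero Level.zero
digraph V E = record { Vtx = V ; _≈_ = _≡_ ; isEquivalence = ≡-isEquivalence ; Arc = E }

module _ (V : Set) (E : Rel V Level.zero) where
  private D = digraph V E

  Component : Set₁
  Component = Σ (Pred V Level.zero) (IsStrongComponent D)

  _≈*_ : Rel Component Level.zero
  C₁ ≈* C₂ = ∀ v → (proj₁ C₁ v → proj₁ C₂ v) × (proj₁ C₂ v → proj₁ C₁ v)

  ≈*-isEquivalence : IsEquivalence _≈*_
  ≈*-isEquivalence = record
    { refl  = λ v → (λ x → x) , (λ x → x)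
    ; sym   = λ p v → proj₂ (p v) , proj₁ (p v)
    ; trans = λ p q v → (λ x → proj₁ (q v) (proj₁ (p v) x))
                      , (λ x → proj₂ (p v) (proj₂ (q v) x))
    }

  Arc* : Rel Component Level.zero
  Arc* C₁ C₂ = ¬ (C₁ ≈* C₂) ×
    Σ V λ u → Σ V λ v → proj₁ C₁ u × proj₁ C₂ v × E u v

  condensation : Digraph (lsuc Level.zero) Level.zero Level.zero
  condensation = record
    { Vtx = Component ; _≈_ = _≈*_ ; isEquivalence = ≈*-isEquivalence ; Arc = Arc* }

FinitelyManyStrongComponents : (V : Set) (E : Rel V Level.zero) → Set₁
FinitelyManyStrongComponents V E =
  Σ (List (Pred V Level.zero)) λ Cs →
    All (IsStrongComponent (digraph V E)) Cs ×
    (∀ C → IsStrongComponent (digraph V E) C → Any (λ C′ → ∀ v → (C v → C′ v) × (C′ v → C v)) Cs)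

IsFinite : Set → Set
IsFinite V = Σ ℕ λ n → Σ (Fin n → V) λ f → ∀ v → Σ (Fin n) λ i → f i ≡ v

-- Call a vertex initial if it reaches every vertex that reaches it, i.e. if it lies in an
-- initial strong component.  Every condition of (a) is equivalent to: every vertex is reachable
-- from an initial vertex.  A member of a point- or arc-basis is initial, since a member reachable
-- from another member could be dropped.  Conversely, one chosen representative inside S of each
-- initial strong component (for arc-bases: of each one with an arc leaving it) is a basis inside
-- the reaching set S.  Sources of D* are exactly the initial strong components.  For (b): if some
-- vertex has no initial ancestor, repeatedly following an arc that enters the current strong
-- component from outside gives a strictly descending chain of components, an in-ray of D* that
-- meets infinitely many strong components.

module Submission where

open import Defs
open import Level using (0ℓ)
open import Axiom.ExcludedMiddle using (ExcludedMiddle)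
open import Data.Empty using (⊥; ⊥-elim)
open import Data.Fin using (Fin; toℕ)
open import Data.Fin.Properties using (pigeonhole)
open import Data.List using (List; length; lookup; tabulate)
open import Data.List.Membership.Propositional.Properties using (∈-lookup)
open import Data.List.Relation.Unary.All as All using (All)
open import Data.List.Relation.Unary.All.Properties as All using ()
open import Data.List.Relation.Unary.Any as Any using (Any)
open import Data.List.Relation.Unary.Any.Properties as Any using (lookup-index)
open import Data.Nat using (ℕ; zero; suc; _<_; _≤′_; ≤′-refl; ≤′-step)
open import Data.Nat.Properties using (<⇒≢; ≤⇒≤′; <-cmp; n<1+n)
open import Data.Product using (Σ; _×_; _,_; proj₁; proj₂)
open import Data.Unit using (⊤; tt)
open import Function.Base using (_∘_; _on_)
open import Function.Bundles using (_⇔_; mk⇔; Equivalence)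
open import Function.Construct.Composition using (_⇔-∘_)
open import Function.Construct.Symmetry using (⇔-sym)
open import Relation.Binary using (Rel; IsEquivalence; Reflexive; Transitive; tri<; tri≈; tri>)
import Relation.Binary.Construct.On as On
open import Relation.Binary.PropositionalEquality using (_≡_; _≢_; refl; sym; cong; subst; module ≡-Reasoning)
open import Relation.Nullary using (¬_; yes; no)
open import Relation.Unary using (Pred; _⊆_)

reachIn⇒reach : ∀ {c ℓ a} (G : Digraph c ℓ a) {C x y} → ReachIn G C x y → Reach G x y
reachIn⇒reach G (here _ _ x≈y) = here x≈y
reachIn⇒reach G (step _ e p)   = step e (reachIn⇒reach G p)

finiteCover-impossible : ∀ {a b} {X : Set a} (xs : List X) (Q : X → ℕ → Set b) →
  (∀ n → Any (λ x → Q x n) xs) → All (λ x → ∀ i j → Q x i → Q x j → i ≡ j) xs → ⊥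
finiteCover-impossible xs Q cover atMostOnce =
  let (i , j , i<j , sameSlot) = pigeonhole (n<1+n (length xs)) slot
      Qi = lookup-index (cover (toℕ i))
      Qj = subst (λ k → Q (lookup xs k) (toℕ j)) (sym sameSlot) (lookup-index (cover (toℕ j)))
  in <⇒≢ i<j (All.lookup atMostOnce (∈-lookup _) _ _ Qi Qj)
  where
    slot : Fin (suc (length xs)) → Fin (length xs)
    slot k = Any.index (cover (toℕ k))

module _ {a ℓ} {A : Set a} {_≲_ : Rel A ℓ} (≲-refl : Reflexive _≲_) (≲-trans : Transitive _≲_)
         (g : ℕ → A) (descends : ∀ n → g (suc n) ≲ g n) (strict : ∀ n → ¬ g n ≲ g (suc n)) where

  strictlyDescending-noAscent : ∀ {m n} → m < n → ¬ g m ≲ g n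
  strictlyDescending-noAscent {m} m<n gm≲gn = strict m (≲-trans gm≲gn (descending (≤⇒≤′ m<n)))
    where
      descending : ∀ {i j} → i ≤′ j → g j ≲ g i
      descending ≤′-refl       = ≲-refl
      descending (≤′-step i≤j) = ≲-trans (descends _) (descending i≤j)

  strictlyDescending-injective : ∀ i j → g i ≲ g j → g j ≲ g i → i ≡ j
  strictlyDescending-injective i j gi≲gj gj≲gi with <-cmp i j
  ... | tri< i<j _ _ = ⊥-elim (strictlyDescending-noAscent i<j gi≲gj)
  ... | tri≈ _ i≡j _ = i≡j
  ... | tri> _ _ j<i = ⊥-elim (strictlyDescending-noAscent j<i gj≲gi)

module Reachability (V : Set) (E : Rel V 0ℓ) where

  private
    D  = digraph V E
    D* = condensation V E

  infix 4 _↝_ _⇆_ _↝*_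

  _↝_ : Rel V 0ℓ
  _↝_ = Reach D

  _↝*_ : Component V E → Component V E → Set₁
  _↝*_ = Reach D*

  ↝-refl : Reflexive _↝_
  ↝-refl = here refl

  ↝-trans : Transitive _↝_
  ↝-trans (here refl) q = q
  ↝-trans (step e p)  q = step e (↝-trans p q)

  arc⇒↝ : ∀ {x y} → E x y → x ↝ y
  arc⇒↝ e = step e ↝-refl

  _⇆_ : Rel V 0ℓ
  x ⇆ y = x ↝ y × y ↝ x

  ⇆-isEquivalence : IsEquivalence _⇆_
  ⇆-isEquivalence = record
    { refl  = ↝-refl , ↝-refl
    ; sym   = λ (x↝y , y↝x) → y↝x , x↝y
    ; trans = λ (x↝y , y↝x) (y↝z , z↝y) → ↝-trans x↝y y↝z , ↝-trans z↝y y↝x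
    }

  open IsEquivalence ⇆-isEquivalence public using () renaming (refl to ⇆-refl; sym to ⇆-sym; trans to ⇆-trans)

  firstArc : ∀ {s x y} → s ↝ x → E x y → Σ V (E s)
  firstArc (here refl) e = _ , e
  firstArc (step e _)  _ = _ , e

  component : V → Pred V 0ℓ
  component = _⇆_

  Initial : Pred V 0ℓ
  Initial s = ∀ u → u ↝ s → s ↝ u

  InitiallyRooted : Set
  InitiallyRooted = ∀ v → Σ V λ s → Initial s × s ↝ v

  Reached : Pred V 0ℓ → Pred V 0ℓ
  Reached B x = Σ V λ b → B b × b ↝ x

  initial-⇆ : ∀ {s t} → Initial s → s ⇆ t → Initial t
  initial-⇆ s-initial (s↝t , t↝s) u u↝t = ↝-trans t↝s (s-initial u (↝-trans u↝t t↝s))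

  ↝source⇒≡ : ∀ {u v} → IsSource D v → u ↝ v → u ≡ v
  ↝source⇒≡ v-source (here u≡v) = u≡v
  ↝source⇒≡ v-source (step e p) with ↝source⇒≡ v-source p
  ... | refl = ⊥-elim (v-source _ e)

  source⇒initial : ∀ {v} → IsSource D v → Initial v
  source⇒initial v-source u u↝v = here (sym (↝source⇒≡ v-source u↝v))

  ↝⇒reachIn-component : ∀ {v x y} → x ↝ y → component v x → component v y → ReachIn D (component v) x y
  ↝⇒reachIn-component (here x≡y) vx vy = here vx vy x≡y
  ↝⇒reachIn-component (step e p) vx vy =
    step vx e (↝⇒reachIn-component p (↝-trans (proj₁ vx) (arc⇒↝ e) , ↝-trans p (proj₂ vy)) vy)

  component-isStrongComponent : ∀ v → IsStrongComponent D (component v)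
  component-isStrongComponent v =
    (λ { refl vx → vx }) ,
    (v , ⇆-refl) ,
    (λ x y vx vy → ↝⇒reachIn-component (↝-trans (proj₂ vx) (proj₁ vy)) vx vy) ,
    λ C′ v⊆C′ C′-sc {w} C′w →
      let C′v = v⊆C′ ⇆-refl
      in reachIn⇒reach D (C′-sc v w C′v C′w) , reachIn⇒reach D (C′-sc w v C′w C′v)

  strongComponent≐component : ∀ {C x} → IsStrongComponent D C → C x →
    ∀ w → (C w → x ⇆ w) × (x ⇆ w → C w)
  strongComponent≐component {C} {x} (_ , _ , C-sc , C-maximal) Cx w =
    both-ways ,
    C-maximal (component x) both-ways (proj₁ (proj₂ (proj₂ (component-isStrongComponent x))))
    where
      both-ways : ∀ {y} → C y → x ⇆ y
      both-ways {y} Cy = reachIn⇒reach D (C-sc x y Cx Cy) , reachIn⇒reach D (C-sc y x Cy Cx)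

  componentOf : V → Component V E
  componentOf v = component v , component-isStrongComponent v

  withinComponent : ∀ (X : Component V E) {x y} → proj₁ X x → proj₁ X y → x ↝ y
  withinComponent (_ , _ , _ , C-sc , _) Cx Cy = reachIn⇒reach D (C-sc _ _ Cx Cy)

  member-⇆ : ∀ (X : Component V E) {x y} → proj₁ X x → x ⇆ y → proj₁ X y
  member-⇆ (C , C-isSC) Cx x⇆y = proj₂ (strongComponent≐component C-isSC Cx _) x⇆y

  sharedMember⇒≈* : ∀ (X Y : Component V E) {x} → proj₁ X x → proj₁ Y x → _≈*_ V E X Y
  sharedMember⇒≈* (_ , C-isSC) (_ , C′-isSC) Cx C′x w =
    let (C→x⇆ , x⇆→C) = strongComponent≐component C-isSC Cx w
        (C′→x⇆ , x⇆→C′) = strongComponent≐component C′-isSC C′x w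
    in x⇆→C′ ∘ C→x⇆ , x⇆→C ∘ C′→x⇆

  ↝*-project : ∀ {X Y a b} → X ↝* Y → proj₁ X a → proj₁ Y b → a ↝ b
  ↝*-project {X} (here X≈Y) Xa Yb = withinComponent X Xa (proj₂ (X≈Y _) Yb)
  ↝*-project {X} (step (_ , _ , _ , Xu , Zw , e) p) Xa Yb =
    ↝-trans (withinComponent X Xa Xu) (step e (↝*-project p Zw Yb))

  InitialComponentInEveryShadow : Set₁
  InitialComponentInEveryShadow =
    ∀ v → Σ (Pred V 0ℓ) λ C → IsInitialStrongComponent D C × C ⊆ Shadow D v

  SourceInEveryShadow* : Set₁
  SourceInEveryShadow* = ∀ X → Σ (Component V E) λ S → Shadow D* X S × IsSource D* S

  initial⇒initialComponent : ∀ {s} → Initial s → IsInitialStrongComponent D (component s)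
  initial⇒initialComponent s-initial =
    component-isStrongComponent _ ,
    λ u w e ¬su sw → let u↝s = step e (proj₂ sw) in ¬su (s-initial u u↝s , u↝s)

  rooted⇒initialComponents : InitiallyRooted → InitialComponentInEveryShadow
  rooted⇒initialComponents rooted v =
    let (s , s-initial , s↝v) = rooted v
    in component s , initial⇒initialComponent s-initial , λ sw → ↝-trans (proj₂ sw) s↝v

  source*⇒initialComponent : ∀ {X} → IsSource D* X → IsInitialStrongComponent D (proj₁ X)
  source*⇒initialComponent {C , C-isSC} X-source =
    C-isSC ,
    λ u w e ¬Cu Cw →
      X-source (componentOf u) ((λ u≈X → ¬Cu (proj₁ (u≈X u) ⇆-refl)) , u , w , ⇆-refl , Cw , e)

  sources*⇒initialComponents : SourceInEveryShadow* → InitialComponentInEveryShadow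
  sources*⇒initialComponents sources v =
    let (X , X↝v , X-source) = sources (componentOf v)
    in proj₁ X , source*⇒initialComponent {X} X-source , λ Xw → ↝*-project X↝v Xw ⇆-refl

  finite⇒finitelyManyStrongComponents : IsFinite V → FinitelyManyStrongComponents V E
  finite⇒finitelyManyStrongComponents (n , f , onto) =
    tabulate (component ∘ f) , All.tabulate⁺ (λ i → component-isStrongComponent (f i)) , covered
    where
      covered : ∀ C → IsStrongComponent D C →
                Any (λ C′ → ∀ v → (C v → C′ v) × (C′ v → C v)) (tabulate (component ∘ f))
      covered C C-isSC with proj₁ (proj₂ C-isSC)
      ... | w , Cw with onto w
      ... | i , refl = Any.tabulate⁺ i (strongComponent≐component C-isSC Cw)

module Classical (lem : ∀ {ℓ} → ExcludedMiddle ℓ) (V : Set) (E : Rel V 0ℓ) where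

  open Reachability V E

  private
    D  = digraph V E
    D* = condensation V E

  enteringArc : ∀ {C : Pred V 0ℓ} {u w} → u ↝ w → ¬ C u → C w →
                Σ V λ x → Σ V λ y → E x y × ¬ C x × C y
  enteringArc (here refl) ¬Cu Cu = ⊥-elim (¬Cu Cu)
  enteringArc {C} (step {y = u′} e p) ¬Cu Cw with lem {P = C u′}
  ... | yes Cu′  = _ , u′ , e , ¬Cu , Cu′
  ... | no ¬Cu′ = enteringArc p ¬Cu′ Cw

  initialComponent-closed : ∀ {C u w} → IsInitialStrongComponent D C → u ↝ w → C w → C u
  initialComponent-closed {C} {u} (_ , noEntry) u↝w Cw with lem {P = C u}
  ... | yes Cu = Cu
  ... | no ¬Cu = let (x , y , e , ¬Cx , Cy) = enteringArc u↝w ¬Cu Cw in ⊥-elim (noEntry x y e ¬Cx Cy)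

  initialComponent-initial : ∀ {C s} → IsInitialStrongComponent D C → C s → Initial s
  initialComponent-initial ic Cs u u↝s = withinComponent (_ , proj₁ ic) Cs (initialComponent-closed ic u↝s Cs)

  initialComponents⇒rooted : InitialComponentInEveryShadow → InitiallyRooted
  initialComponents⇒rooted initials v =
    let (C , ic , C⊆shadow) = initials v
        (s , Cs) = proj₁ (proj₂ (proj₁ ic))
    in s , initialComponent-initial ic Cs , C⊆shadow Cs

  ↝-lift : ∀ {a b} (X Y : Component V E) → a ↝ b → proj₁ X a → proj₁ Y b → X ↝* Y
  ↝-lift X Y (here refl) Xa Ya = here (sharedMember⇒≈* X Y Xa Ya)
  ↝-lift {a} X Y (step {y = a′} e p) Xa Yb with lem {P = a′ ↝ a}
  ... | yes a′↝a  = ↝-lift X Y p (member-⇆ X Xa (arc⇒↝ e , a′↝a)) Yb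
  ... | no ¬a′↝a = step (X≉a′ , a , a′ , Xa , ⇆-refl , e) (↝-lift (componentOf a′) Y p ⇆-refl Yb)
    where
      X≉a′ : ¬ _≈*_ V E X (componentOf a′)
      X≉a′ X≈a′ = ¬a′↝a (proj₁ (proj₁ (X≈a′ a) Xa))

  initialComponent⇒source* : ∀ {C} (ic : IsInitialStrongComponent D C) → IsSource D* (C , proj₁ ic)
  initialComponent⇒source* {C} ic U (U≉C , a , b , Ua , Cb , e) =
    U≉C (sharedMember⇒≈* U (C , proj₁ ic) Ua (initialComponent-closed ic (arc⇒↝ e) Cb))

  initialComponents⇒sources* : InitialComponentInEveryShadow → SourceInEveryShadow*
  initialComponents⇒sources* initials X =
    let (v , Xv) = proj₁ (proj₂ (proj₂ X))
        (C , ic , C⊆shadow) = initials v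
        (s , Cs) = proj₁ (proj₂ (proj₁ ic))
    in (C , proj₁ ic) , ↝-lift (C , proj₁ ic) X (C⊆shadow Cs) Cs Xv , initialComponent⇒source* ic

  _without_ : Pred V 0ℓ → V → Pred V 0ℓ
  (B without u) x = B x × x ≢ u

  reroute : ∀ {B u x} → Reached (B without u) u → Reached B x → Reached (B without u) x
  reroute {u = u} u-reached (b , Bb , b↝x) with lem {P = b ≡ u}
  ... | yes refl = let (b′ , B∖u-b′ , b′↝u) = u-reached in b′ , B∖u-b′ , ↝-trans b′↝u b↝x
  ... | no b≢u  = b , (Bb , b≢u) , b↝x

  pointBasis-irredundant : ∀ {B u} → IsPointBasis D B → B u → ¬ Reached (B without u) u
  pointBasis-irredundant (reaching , minimal) Bu u-reached =
    proj₂ (minimal _ proj₁ (λ v → reroute u-reached (reaching v)) Bu) refl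

  arcBasis-irredundant : ∀ {B u} → IsArcBasis D B → B u → ¬ Reached (B without u) u
  arcBasis-irredundant (reaching , minimal) Bu u-reached =
    proj₂ (minimal _ proj₁ (λ x y e → reroute u-reached (reaching x y e)) Bu) refl

  irredundant-reachesBack : ∀ {B u w} → ¬ Reached (B without u) u → w ↝ u → Reached B w → u ↝ w
  irredundant-reachesBack {u = u} irredundant w↝u (b , Bb , b↝w) with lem {P = b ≡ u}
  ... | yes refl = b↝w
  ... | no b≢u  = ⊥-elim (irredundant (b , (Bb , b≢u) , ↝-trans b↝w w↝u))

  pointBasis⇒rooted : HasPointBasis D → InitiallyRooted
  pointBasis⇒rooted (B , basis@(reaching , _)) v =
    let (b , Bb , b↝v) = reaching v
    in b , (λ w w↝b → irredundant-reachesBack (pointBasis-irredundant basis Bb) w↝b (reaching w)) , b↝v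

  arcBasis⇒rooted : HasArcBasis D → InitiallyRooted
  arcBasis⇒rooted (B , basis@(reaching , _)) v with lem {P = Σ V λ x → E x v}
  ... | no noArcIn   = v , source⇒initial (λ x e → noArcIn (x , e)) , ↝-refl
  ... | yes (x , e) = let (b , Bb , b↝x) = reaching x v e in b , basis-initial Bb , ↝-trans b↝x (arc⇒↝ e)
    where
      basis-initial : ∀ {b} → B b → Initial b
      basis-initial Bb w (here refl)    = ↝-refl
      basis-initial Bb w w↝b@(step e _) =
        irredundant-reachesBack (arcBasis-irredundant basis Bb) w↝b (reaching _ _ e)

  Unrooted : Pred V 0ℓ
  Unrooted v = ¬ (Σ V λ s → Initial s × s ↝ v)

  rooted-unless-unrooted : (∀ v → ¬ Unrooted v) → InitiallyRooted
  rooted-unless-unrooted rooted v with lem {P = Σ V λ s → Initial s × s ↝ v}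
  ... | yes root     = root
  ... | no unrooted = ⊥-elim (rooted v unrooted)

  nonInitial⇒enteringArc : ∀ {u} → ¬ Initial u → Σ V λ x → Σ V λ y → E x y × ¬ u ⇆ x × u ⇆ y
  nonInitial⇒enteringArc {u} ¬initial with lem {P = Σ V λ w → w ↝ u × ¬ u ↝ w}
  ... | yes (w , w↝u , ¬u↝w) = enteringArc {C = component u} w↝u (λ u⇆w → ¬u↝w (proj₁ u⇆w)) ⇆-refl
  ... | no noEscape = ⊥-elim (¬initial initial)
    where
      initial : Initial u
      initial w w↝u with lem {P = u ↝ w}
      ... | yes u↝w  = u↝w
      ... | no ¬u↝w = ⊥-elim (noEscape (w , w↝u , ¬u↝w))

  unrooted⇒enteringArc : ∀ {u} → Unrooted u → Σ V λ x → Σ V λ y → E x y × ¬ u ⇆ x × u ⇆ y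
  unrooted⇒enteringArc {u} unrooted = nonInitial⇒enteringArc λ u-initial → unrooted (u , u-initial , ↝-refl)

  module Descent {v} (v-unrooted : Unrooted v) where

    chain : ℕ → Σ V Unrooted
    chain zero    = v , v-unrooted
    chain (suc n) = predecessor (chain n)
      where
        predecessor : Σ V Unrooted → Σ V Unrooted
        predecessor (u , u-unrooted) =
          let (x , y , e , _ , u⇆y) = unrooted⇒enteringArc u-unrooted
          in x , λ (s , s-initial , s↝x) → u-unrooted (s , s-initial , ↝-trans s↝x (step e (proj₂ u⇆y)))

    g : ℕ → V
    g n = proj₁ (chain n)

    entering : ∀ n → Σ V λ y → E (g (suc n)) y × ¬ g n ⇆ g (suc n) × g n ⇆ y
    entering n = proj₂ (unrooted⇒enteringArc (proj₂ (chain n)))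

    g-descends : ∀ n → g (suc n) ↝ g n
    g-descends n = let (_ , e , _ , gn⇆y) = entering n in step e (proj₂ gn⇆y)

    g-strict : ∀ n → ¬ g n ↝ g (suc n)
    g-strict n gn↝gsn = let (_ , _ , gn⇎gsn , _) = entering n in gn⇎gsn (gn↝gsn , g-descends n)

    g-injective : ∀ i j → g i ⇆ g j → i ≡ j
    g-injective i j (gi↝gj , gj↝gi) =
      strictlyDescending-injective {_≲_ = _↝_} ↝-refl ↝-trans g g-descends g-strict i j gi↝gj gj↝gi

    inRay : InRay D*
    inRay = componentOf ∘ g , arc* , distinct , λ (Cs , all-sc , cover) →
      finiteCover-impossible Cs (λ C n → C (componentOf (g n))) cover (All.map atMostOnce all-sc)
      where
        arc* : ∀ n → Arc* V E (componentOf (g (suc n))) (componentOf (g n))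
        arc* n =
          let (y , e , gn⇎gsn , gn⇆y) = entering n
          in (λ gsn≈gn → gn⇎gsn (proj₁ (gsn≈gn _) ⇆-refl)) , _ , y , ⇆-refl , gn⇆y , e
        distinct : ∀ i j → _≈*_ V E (componentOf (g i)) (componentOf (g j)) → i ≡ j
        distinct i j gi≈gj = g-injective i j (proj₂ (gi≈gj _) ⇆-refl)
        atMostOnce : ∀ {C} → IsStrongComponent D* C →
                     ∀ i j → C (componentOf (g i)) → C (componentOf (g j)) → i ≡ j
        atMostOnce (_ , _ , C-sc , _) i j Ci Cj = g-injective i j
          ( ↝*-project (reachIn⇒reach D* (C-sc _ _ Ci Cj)) ⇆-refl ⇆-refl
          , ↝*-project (reachIn⇒reach D* (C-sc _ _ Cj Ci)) ⇆-refl ⇆-refl )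

    ¬finitelyManyStrongComponents : ¬ FinitelyManyStrongComponents V E
    ¬finitelyManyStrongComponents (Cs , _ , cover) =
      finiteCover-impossible Cs Equals (λ n → cover _ (component-isStrongComponent (g n)))
        (All.universal atMostOnce Cs)
      where
        Equals : Pred V 0ℓ → ℕ → Set
        Equals C n = ∀ w → (component (g n) w → C w) × (C w → component (g n) w)
        atMostOnce : ∀ C i j → Equals C i → Equals C j → i ≡ j
        atMostOnce C i j gi≐C gj≐C =
          g-injective i j (⇆-sym (proj₂ (gj≐C (g i)) (proj₁ (gi≐C (g i)) ⇆-refl)))

  noInRay*⇒rooted : ¬ InRay D* → InitiallyRooted
  noInRay*⇒rooted noInRay = rooted-unless-unrooted λ _ unrooted → noInRay (Descent.inRay unrooted)

  finitelyManyStrongComponents⇒rooted : FinitelyManyStrongComponents V E → InitiallyRooted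
  finitelyManyStrongComponents⇒rooted finitelyMany =
    rooted-unless-unrooted λ _ unrooted → Descent.¬finitelyManyStrongComponents unrooted finitelyMany

module Bases (choice : RepresentativeChoice 0ℓ 0ℓ) (V : Set) (E : Rel V 0ℓ) where

  open Reachability V E

  private
    D = digraph V E

  module Representatives (S : Pred V 0ℓ) where

    private
      representative = choice {A = Σ V S} (_⇆_ on proj₁) (On.isEquivalence proj₁ ⇆-isEquivalence)
      rep = proj₁ representative

    Canonical : Pred V 0ℓ
    Canonical v = Σ (S v) λ Sv → proj₁ (rep (v , Sv)) ≡ v

    canonicalRepresentative : ∀ {u} → S u → Σ V λ c → Canonical c × c ⇆ u
    canonicalRepresentative {u} Su =
      c , (Sc , cong proj₁ (respects (c , Sc) (u , Su) (⇆-sym u⇆c))) , ⇆-sym u⇆c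
      where
        c = proj₁ (rep (u , Su))
        Sc = proj₂ (rep (u , Su))
        u⇆c = proj₁ (proj₂ representative) (u , Su)
        respects = proj₂ (proj₂ representative)

    canonical-unique : ∀ {x y} → Canonical x → Canonical y → x ⇆ y → x ≡ y
    canonical-unique {x} {y} (Sx , rx≡x) (Sy , ry≡y) x⇆y = begin
      x                     ≡⟨ sym rx≡x ⟩
      proj₁ (rep (x , Sx))  ≡⟨ cong proj₁ (proj₂ (proj₂ representative) _ _ x⇆y) ⟩
      proj₁ (rep (y , Sy))  ≡⟨ ry≡y ⟩
      y                     ∎
      where open ≡-Reasoning

    initialRepresentative : ∀ {s u} → Initial s → S u → u ↝ s →
                            Σ V λ c → (Canonical c × Initial c) × c ⇆ s
    initialRepresentative {u = u} s-initial Su u↝s =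
      let (c , c-canonical , c⇆u) = canonicalRepresentative Su
          c⇆s = ⇆-trans c⇆u (u↝s , s-initial u u↝s)
      in c , (c-canonical , initial-⇆ s-initial (⇆-sym c⇆s)) , c⇆s

    canonicalInitial-minimal : ∀ {B T : Pred V 0ℓ} → B ⊆ Canonical → B ⊆ Initial →
      T ⊆ B → (∀ {v} → B v → Reached T v) → B ⊆ T
    canonicalInitial-minimal {T = T} B⊆canonical B⊆initial T⊆B reached {v} Bv =
      let (t , Tt , t↝v) = reached Bv
          v≡t = canonical-unique (B⊆canonical Bv) (B⊆canonical (T⊆B Tt)) (B⊆initial Bv t t↝v , t↝v)
      in subst T (sym v≡t) Tt

  PointBasisInsideEveryPointReachingSet : Set₁
  PointBasisInsideEveryPointReachingSet =
    ∀ S → PointReaching D S → Σ (Pred V 0ℓ) λ B → B ⊆ S × IsPointBasis D B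

  ArcBasisInsideEveryArcReachingSet : Set₁
  ArcBasisInsideEveryArcReachingSet =
    ∀ S → ArcReaching D S → Σ (Pred V 0ℓ) λ B → B ⊆ S × IsArcBasis D B

  rooted⇒pointBasisInside : InitiallyRooted → PointBasisInsideEveryPointReachingSet
  rooted⇒pointBasisInside rooted S S-reaching =
    B , (λ Bv → proj₁ (proj₁ Bv)) , reaching ,
    λ T T⊆B T-reaching → canonicalInitial-minimal proj₁ proj₂ T⊆B (λ {v} _ → T-reaching v)
    where
      open Representatives S
      B : Pred V 0ℓ
      B v = Canonical v × Initial v
      reaching : PointReaching D B
      reaching y =
        let (s , s-initial , s↝y) = rooted y
            (u , Su , u↝s) = S-reaching s
            (c , Bc , c⇆s) = initialRepresentative s-initial Su u↝s
        in c , Bc , ↝-trans (proj₁ c⇆s) s↝y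

  rooted⇒arcBasisInside : InitiallyRooted → ArcBasisInsideEveryArcReachingSet
  rooted⇒arcBasisInside rooted S S-reaching =
    B , (λ Bv → proj₁ (proj₁ (proj₁ Bv))) , reaching ,
    λ T T⊆B T-reaching →
      canonicalInitial-minimal (proj₁ ∘ proj₁) (proj₂ ∘ proj₁) T⊆B (reachedVia T-reaching)
    where
      open Representatives S
      B : Pred V 0ℓ
      B v = (Canonical v × Initial v) × (Σ V λ x → Σ V λ y → v ⇆ x × E x y)
      reaching : ArcReaching D B
      reaching x y e =
        let (s , s-initial , s↝x) = rooted x
            (z , s→z) = firstArc s↝x e
            (u , Su , u↝s) = S-reaching s z s→z
            (c , c-canonicalInitial , c⇆s) = initialRepresentative s-initial Su u↝s
        in c , (c-canonicalInitial , s , z , c⇆s , s→z) , ↝-trans (proj₁ c⇆s) s↝x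
      reachedVia : ∀ {T} → ArcReaching D T → ∀ {v} → B v → Reached T v
      reachedVia T-reaching (_ , x , y , v⇆x , e) =
        let (t , Tt , t↝x) = T-reaching x y e in t , Tt , ↝-trans t↝x (proj₂ v⇆x)

  pointBasisInside⇒pointBasis : PointBasisInsideEveryPointReachingSet → HasPointBasis D
  pointBasisInside⇒pointBasis inside =
    let (B , _ , basis) = inside (λ _ → ⊤) (λ v → v , tt , ↝-refl) in B , basis

  arcBasisInside⇒arcBasis : ArcBasisInsideEveryArcReachingSet → HasArcBasis D
  arcBasisInside⇒arcBasis inside =
    let (B , _ , basis) = inside (λ _ → ⊤) (λ u _ _ → u , tt , ↝-refl) in B , basis

module Characterisations (lem : ∀ {ℓ} → ExcludedMiddle ℓ) (choice : RepresentativeChoice 0ℓ 0ℓ)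
                        (V : Set) (E : Rel V 0ℓ) where

  open Reachability V E
  open Classical lem V E
  open Bases choice V E

  pointBasis⇔rooted : HasPointBasis (digraph V E) ⇔ InitiallyRooted
  pointBasis⇔rooted = mk⇔ pointBasis⇒rooted (pointBasisInside⇒pointBasis ∘ rooted⇒pointBasisInside)

  arcBasis⇔rooted : HasArcBasis (digraph V E) ⇔ InitiallyRooted
  arcBasis⇔rooted = mk⇔ arcBasis⇒rooted (arcBasisInside⇒arcBasis ∘ rooted⇒arcBasisInside)

  initialComponents⇔rooted : InitialComponentInEveryShadow ⇔ InitiallyRooted
  initialComponents⇔rooted = mk⇔ initialComponents⇒rooted rooted⇒initialComponents

  sources*⇔rooted : SourceInEveryShadow* ⇔ InitiallyRooted
  sources*⇔rooted = initialComponents⇔rooted ⇔-∘ mk⇔ sources*⇒initialComponents initialComponents⇒sources*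

  pointBasisInside⇔rooted : PointBasisInsideEveryPointReachingSet ⇔ InitiallyRooted
  pointBasisInside⇔rooted = mk⇔ (pointBasis⇒rooted ∘ pointBasisInside⇒pointBasis) rooted⇒pointBasisInside

  arcBasisInside⇔rooted : ArcBasisInsideEveryArcReachingSet ⇔ InitiallyRooted
  arcBasisInside⇔rooted = mk⇔ (arcBasis⇒rooted ∘ arcBasisInside⇒arcBasis) rooted⇒arcBasisInside

  rooted⇒bases : InitiallyRooted → HasPointBasis (digraph V E) × HasArcBasis (digraph V E)
  rooted⇒bases rooted = Equivalence.from pointBasis⇔rooted rooted , Equivalence.from arcBasis⇔rooted rooted

theorem16 : (lem : ∀ {ℓ} → ExcludedMiddle ℓ) →
    (choice : ∀ {a ℓ} → RepresentativeChoice a ℓ) →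
    (V : Set) (E : Rel V 0ℓ) → (∀ v → ¬ E v v) →
    -- (a): (i) ⇔ (ii), (i) ⇔ (iii), (i) ⇔ (iv), (i) ⇔ (v), (i) ⇔ (vi)
    ((HasPointBasis (digraph V E) ⇔ HasArcBasis (digraph V E)) ×
     (HasPointBasis (digraph V E) ⇔
        (∀ v → Σ (Pred V 0ℓ) λ C →
           IsInitialStrongComponent (digraph V E) C × C ⊆ Shadow (digraph V E) v)) ×
     (HasPointBasis (digraph V E) ⇔
        (∀ x → Σ (Component V E) λ s →
           Shadow (condensation V E) x s × IsSource (condensation V E) s)) ×
     (HasPointBasis (digraph V E) ⇔
        (∀ S → PointReaching (digraph V E) S →
           Σ (Pred V 0ℓ) λ B → B ⊆ S × IsPointBasis (digraph V E) B)) ×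
     (HasPointBasis (digraph V E) ⇔
        (∀ S → ArcReaching (digraph V E) S →
           Σ (Pred V 0ℓ) λ B → B ⊆ S × IsArcBasis (digraph V E) B))) ×
    -- (b)
    ((¬ HasInRay (condensation V E) →
        HasPointBasis (digraph V E) × HasArcBasis (digraph V E)) ×
     (FinitelyManyStrongComponents V E →
        HasPointBasis (digraph V E) × HasArcBasis (digraph V E)) ×
     (IsFinite V →
        HasPointBasis (digraph V E) × HasArcBasis (digraph V E)))
theorem16 lem choice V E _ =
  ( ⇔-sym arcBasis⇔rooted ⇔-∘ pointBasis⇔rooted
  , ⇔-sym initialComponents⇔rooted ⇔-∘ pointBasis⇔rooted
  , ⇔-sym sources*⇔rooted ⇔-∘ pointBasis⇔rooted
  , ⇔-sym pointBasisInside⇔rooted ⇔-∘ pointBasis⇔rooted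
  , ⇔-sym arcBasisInside⇔rooted ⇔-∘ pointBasis⇔rooted
  ) ,
  ( rooted⇒bases ∘ noInRay*⇒rooted
  , rooted⇒bases ∘ finitelyManyStrongComponents⇒rooted
  , rooted⇒bases ∘ finitelyManyStrongComponents⇒rooted ∘ finite⇒finitelyManyStrongComponents
  )
  where
    open Reachability V E
    open Classical lem V E
    open Characterisations lem choice V E
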